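{- Let $w$ be a factor of $f_{\infty,\infty}$ of size $(k,l)$, $k,l\ge1$, with first column $L$ (a word of length $k$) and first row $T$ (a word of length $l$). Let the column word of $w$ be $f_\infty^{d,b}$ if the top-left letter of $w$ is in $\{d,b\}$ and $f_\infty^{c,a}$ otherwise, and the row word of $w$ be $f_\infty^{d,c}$ if the top-left letter is in $\{d,c\}$ and $f_\infty^{b,a}$ otherwise. Let $fo_L$ be the first occurrence of $L$ in the column word of $w$ and $fo_T$ the first occurrence of $T$ in the row word of $w$. Then $\textit{first-occ}(w)=(fo_L,fo_T)$.
   Context: For letters $s_1,s_2$, $f_\infty^{s_1,s_2}=s_1s_2s_1s_1s_2s_1s_2s_1\cdots$ is the image of $x=x_1x_2\cdots=101101011\cdots$ (fixed point of $1\mapsto10,0\mapsto1$) under $1\mapsto s_1,0\mapsto s_2$. $f_{\infty,\infty}=[f(i,j)]_{i,j\ge1}$ over $\{a,b,c,d\}$ is the fixed point $\lim_n\mu^n(d)$ of the $2D$ morphism $d\mapsto\begin{smallmatrix}d&c\\ b&a\end{smallmatrix}$, $c\mapsto\begin{smallmatrix}d\\ b\end{smallmatrix}$, $b\mapsto\begin{smallmatrix}d&c\end{smallmatrix}$, $a\mapsto d$; equivalently $f(i,j)=d,c,b,a$ according as $(x_i,x_j)=(1,1),(1,0),(0,1),(0,0)$. For a one-sided infinite word $y=y_1y_2\cdots$ and a finite word $u$, an occurrence of $u$ is an integer $i\ge0$ with $y_{i+1}\cdots y_{i+|u|}=u$, and the first occurrence is the least such $i$. An occurrence of a $k\times l$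 array $w$ in $f_{\infty,\infty}$ is a pair $(i,j)$, $i,j\ge0$, such that the block of $f_{\infty,\infty}$ in rows $i+1,\dots,i+k$ and columns $j+1,\dots,j+l$ equals $w$; $\textit{first-occ}(w)$ denotes the least occurrence (least $i$, and among those least $j$). -}

module Defs where

open import Data.Bool using (Bool; true; false; if_then_else_)
open import Data.List using (List; []; _∷_; _++_; concatMap; lookup; length)
open import Data.Nat using (ℕ; zero; suc; _+_; _<_)
open import Data.Fin using (Fin; toℕ) renaming (zero to fzero)
open import Data.Product using (_×_; Σ; ∃; _,_)
open import Data.Sum using (_⊎_)
open import Relation.Binary.PropositionalEquality using (_≡_)
open import Relation.Nullary using (¬_)

-- Binary letters: true = 1, false = 0.
-- The Fibonacci morphism σ : 1 ↦ 10, 0 ↦ 1.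
σ : Bool → List Bool
σ true  = true ∷ false ∷ []
σ false = true ∷ []

σ^ : ℕ → List Bool
σ^ zero    = true ∷ []
σ^ (suc n) = concatMap σ (σ^ n)

nth : List Bool → ℕ → Bool
nth []       _       = false
nth (b ∷ _)  zero    = b
nth (_ ∷ bs) (suc n) = nth bs n

-- The fixed point x = x₁x₂⋯ = 101101011⋯ of σ, 0-based:
-- xw p = x_{p+1}, read off from σ^(p+1)(1), which has length > p+1
-- and is a prefix of the fixed point.
xw : ℕ → Bool
xw p = nth (σ^ (suc p)) p

data Letter : Set where
  a b c d : Letter

-- One-sided infinite words, 0-based: y p = y_{p+1}.
InfWord : Set → Set
InfWord A = ℕ → A

fInf : Letter → Letter → InfWord Letter
fInf s₁ s₂ p = if xw p then s₁ else s₂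

-- f_{∞,∞}, 0-based: fII i j = f(i+1, j+1).
-- f(i,j) = d,c,b,a according as (x_i,x_j) = (1,1),(1,0),(0,1),(0,0).
fII : ℕ → ℕ → Letter
fII i j with xw i | xw j
... | true  | true  = d
... | true  | false = c
... | false | true  = b
... | false | false = a

Word : ℕ → Set
Word k = Fin k → Letter

Array : ℕ → ℕ → Set
Array k l = Fin k → Fin l → Letter

Occ : ∀ {k} → InfWord Letter → Word k → ℕ → Set
Occ y u n = ∀ t → y (n + toℕ t) ≡ u t

FirstOcc : ∀ {k} → InfWord Letter → Word k → ℕ → Set
FirstOcc y u n = Occ y u n × (∀ m → m < n → ¬ Occ y u m)

Occ2 : ∀ {k l} → Array k l → ℕ → ℕ → Set
Occ2 w i j = ∀ s t → fII (i + toℕ s) (j + toℕ t) ≡ w s t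

IsFactor : ∀ {k l} → Array k l → Set
IsFactor w = Σ ℕ λ i → Σ ℕ λ j → Occ2 w i j

FirstOcc2 : ∀ {k l} → Array k l → ℕ → ℕ → Set
FirstOcc2 w i j =
  Occ2 w i j ×
  (∀ i' j' → Occ2 w i' j' → (i < i') ⊎ ((i ≡ i') × ¬ (j' < j)))

firstCol : ∀ {k l} → Array k (suc l) → Word k
firstCol w s = w s fzero

firstRow : ∀ {k l} → Array (suc k) l → Word l
firstRow w t = w fzero t

colWord : Letter → InfWord Letter
colWord d = fInf d b
colWord b = fInf d b
colWord c = fInf c a
colWord a = fInf c a

rowWord : Letter → InfWord Letter
rowWord d = fInf d c
rowWord c = fInf d c
rowWord b = fInf b a
rowWord a = fInf b a

{-# OPTIONS --safe #-}
-- A letter of f_{∞,∞} is the pair of bits (x_i, x_j) in disguise.  Hence, given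
-- one occurrence (i₀, j₀) of w, the block at (i, j) equals w iff the factors of x
-- of the height of w at i and at i₀ agree and those of its width at j and at j₀
-- agree: the occurrences of w form a product I × J, whose lexicographically
-- least element is (min I, min J).  Down a column the bit x_j is fixed, so the
-- column through the top-left corner reads x through 1 ↦ s₁, 0 ↦ s₂, i.e. it is
-- the column word; thus I is the set of occurrences of L in the column word, and
-- likewise J is that of T in the row word.
module Submission where

open import Defs
open import Level using (Level)
open import Data.Bool using (Bool; true; false; if_then_else_)
open import Data.Bool.Properties using () renaming (_≟_ to _≟ᵇ_)
open import Data.Fin using (Fin; toℕ; zero)
open import Data.Fin.Properties using (all?)
open import Data.Nat using (ℕ; suc; _+_; _<_)
open import Data.Nat.Induction using (<-rec)
open import Data.Nat.Properties using (anyUpTo?; <-cmp)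
open import Data.Product using (_×_; Σ; ∃; _,_; proj₁; proj₂)
open import Data.Product.Properties using (,-injective)
open import Data.Sum using (_⊎_; inj₁; inj₂)
open import Function.Bundles using (_⇔_; mk⇔; Equivalence)
open import Relation.Binary.Definitions using (tri<; tri≈; tri>)
open import Relation.Binary.PropositionalEquality
  using (_≡_; refl; sym; trans; cong; cong₂)
open import Relation.Nullary using (¬_; yes; no; contradiction)
open import Relation.Unary using (Pred; Decidable)

open Equivalence using (to; from)

variable
  ℓ₁ ℓ₂ ℓ₃ : Level

Least : Pred ℕ ℓ₁ → Pred ℕ ℓ₁
Least P n = P n × (∀ m → m < n → ¬ P m)

least-exists : {P : Pred ℕ ℓ₁} → Decidable P → ∀ n → P n → ∃ (Least P)
least-exists {P = P} P? = <-rec (λ n → P n → ∃ (Least P)) search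
  where
  search : ∀ n → (∀ {m} → m < n → P m → ∃ (Least P)) → P n → ∃ (Least P)
  search n below pn with anyUpTo? P? n
  ... | yes (m , m<n , pm) = below m<n pm
  ... | no none            = n , pn , λ m m<n pm → none (m , m<n , pm)

Least-resp-⇔ : {P : Pred ℕ ℓ₁} {Q : Pred ℕ ℓ₂} → (∀ n → P n ⇔ Q n) → ∀ {n} → Least P n → Least Q n
Least-resp-⇔ P⇔Q (pn , below) = to (P⇔Q _) pn , λ m m<n qm → below m m<n (from (P⇔Q m) qm)

lexLeast-product :
  {P : Pred ℕ ℓ₁} {Q : Pred ℕ ℓ₂} {R : ℕ → ℕ → Set ℓ₃} → (∀ i j → R i j ⇔ (P i × Q j)) →
  ∀ {m n} → Least P m → Least Q n →
  R m n × (∀ i j → R i j → (m < i) ⊎ ((m ≡ i) × ¬ (j < n)))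
lexLeast-product {R = R} R⇔P×Q {m} {n} (pm , belowP) (qn , belowQ) =
  from (R⇔P×Q m n) (pm , qn) , after
  where
  after : ∀ i j → R i j → (m < i) ⊎ ((m ≡ i) × ¬ (j < n))
  after i j rij with to (R⇔P×Q i j) rij | <-cmp m i
  ... | _       | tri< m<i _ _ = inj₁ m<i
  ... | _ , qj  | tri≈ _ m≡i _ = inj₂ (m≡i , λ j<n → belowQ j j<n qj)
  ... | pi , _  | tri> _ _ i<m = contradiction pi (belowP i i<m)

letter : Bool → Bool → Letter
letter true  true  = d
letter true  false = c
letter false true  = b
letter false false = a

bits : Letter → Bool × Bool
bits d = true  , true
bits c = true  , false
bits b = false , true
bits a = false , false

bits-letter : ∀ α β → bits (letter α β) ≡ (α , β)
bits-letter true  true  = refl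
bits-letter true  false = refl
bits-letter false true  = refl
bits-letter false false = refl

letter-injective : ∀ {α β α′ β′} → letter α β ≡ letter α′ β′ → α ≡ α′ × β ≡ β′
letter-injective {α} {β} {α′} {β′} e =
  ,-injective (trans (sym (bits-letter α β)) (trans (cong bits e) (bits-letter α′ β′)))

fII-letter : ∀ i j → fII i j ≡ letter (xw i) (xw j)
fII-letter i j with xw i | xw j
... | true  | true  = refl
... | true  | false = refl
... | false | true  = refl
... | false | false = refl

letter-ifˡ : ∀ α β → letter α β ≡ (if α then letter true β else letter false β)
letter-ifˡ true  _ = refl
letter-ifˡ false _ = refl

letter-ifʳ : ∀ α β → letter α β ≡ (if β then letter α true else letter α false)
letter-ifʳ _ true  = refl
letter-ifʳ _ false = refl

colWord-letter : ∀ α β p → colWord (letter α β) p ≡ letter (xw p) β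
colWord-letter true  true  p = sym (letter-ifˡ (xw p) true)
colWord-letter true  false p = sym (letter-ifˡ (xw p) false)
colWord-letter false true  p = sym (letter-ifˡ (xw p) true)
colWord-letter false false p = sym (letter-ifˡ (xw p) false)

rowWord-letter : ∀ α β p → rowWord (letter α β) p ≡ letter α (xw p)
rowWord-letter true  true  p = sym (letter-ifʳ true (xw p))
rowWord-letter true  false p = sym (letter-ifʳ true (xw p))
rowWord-letter false true  p = sym (letter-ifʳ false (xw p))
rowWord-letter false false p = sym (letter-ifʳ false (xw p))

SameFactor : ℕ → ℕ → ℕ → Set
SameFactor n i i₀ = ∀ (s : Fin n) → xw (i + toℕ s) ≡ xw (i₀ + toℕ s)

sameFactor? : ∀ n i₀ → Decidable (λ i → SameFactor n i i₀)
sameFactor? n i₀ i = all? (λ s → xw (i + toℕ s) ≟ᵇ xw (i₀ + toℕ s))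


letter-at : ∀ {k l} (w : Array k l) i j → Occ2 w i j →
            ∀ s t → w s t ≡ letter (xw (i + toℕ s)) (xw (j + toℕ t))
letter-at w i j o s t = trans (sym (o s t)) (fII-letter (i + toℕ s) (j + toℕ t))

module AtOccurrence {k l} (w : Array (suc k) (suc l)) (i₀ j₀ : ℕ) (occ : Occ2 w i₀ j₀) where

  w-letter : ∀ s t → w s t ≡ letter (xw (i₀ + toℕ s)) (xw (j₀ + toℕ t))
  w-letter = letter-at w i₀ j₀ occ

  occ2⇔sameFactors : ∀ i j → Occ2 w i j ⇔ (SameFactor (suc k) i i₀ × SameFactor (suc l) j j₀)
  occ2⇔sameFactors i j = mk⇔
    (λ o → (λ s → proj₁ (letter-injective (trans (sym (letter-at w i j o s zero)) (w-letter s zero))))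
         , (λ t → proj₂ (letter-injective (trans (sym (letter-at w i j o zero t)) (w-letter zero t)))))
    (λ (same-i , same-j) s t →
      trans (fII-letter (i + toℕ s) (j + toℕ t))
            (trans (cong₂ letter (same-i s) (same-j t)) (sym (w-letter s t))))

  colWord-corner : ∀ p → colWord (w zero zero) p ≡ letter (xw p) (xw (j₀ + 0))
  colWord-corner p =
    trans (cong (λ ℓ → colWord ℓ p) (w-letter zero zero)) (colWord-letter (xw (i₀ + 0)) (xw (j₀ + 0)) p)

  rowWord-corner : ∀ p → rowWord (w zero zero) p ≡ letter (xw (i₀ + 0)) (xw p)
  rowWord-corner p =
    trans (cong (λ ℓ → rowWord ℓ p) (w-letter zero zero)) (rowWord-letter (xw (i₀ + 0)) (xw (j₀ + 0)) p)

  sameFactor⇔colOcc : ∀ i → SameFactor (suc k) i i₀ ⇔ Occ (colWord (w zero zero)) (firstCol w) i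
  sameFactor⇔colOcc i = mk⇔
    (λ same s → trans (colWord-corner (i + toℕ s))
                      (trans (cong (λ α → letter α _) (same s)) (sym (w-letter s zero))))
    (λ o s → proj₁ (letter-injective
                      (trans (sym (colWord-corner (i + toℕ s))) (trans (o s) (w-letter s zero)))))

  sameFactor⇔rowOcc : ∀ j → SameFactor (suc l) j j₀ ⇔ Occ (rowWord (w zero zero)) (firstRow w) j
  sameFactor⇔rowOcc j = mk⇔
    (λ same t → trans (rowWord-corner (j + toℕ t))
                      (trans (cong (letter _) (same t)) (sym (w-letter zero t))))
    (λ o t → proj₂ (letter-injective
                      (trans (sym (rowWord-corner (j + toℕ t))) (trans (o t) (w-letter zero t)))))

mainTheorem7 : (k l : ℕ) (w : Array (suc k) (suc l)) → IsFactor w →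
    Σ ℕ λ foL → Σ ℕ λ foT →
      FirstOcc (colWord (w zero zero)) (firstCol w) foL ×
      FirstOcc (rowWord (w zero zero)) (firstRow w) foT ×
      FirstOcc2 w foL foT
mainTheorem7 k l w (i₀ , j₀ , occ) =
  let open AtOccurrence w i₀ j₀ occ
      (foL , leastL) = least-exists (sameFactor? (suc k) i₀) i₀ (λ _ → refl)
      (foT , leastT) = least-exists (sameFactor? (suc l) j₀) j₀ (λ _ → refl)
  in  foL , foT ,
      Least-resp-⇔ sameFactor⇔colOcc leastL ,
      Least-resp-⇔ sameFactor⇔rowOcc leastT ,
      lexLeast-product occ2⇔sameFactors leastL leastT
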